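{- Let $G$ be a connected $P_5$-free chordal bipartite graph. Then $G$ is Hamiltonian if and only if $G$ is homogeneously traceable.
   Context: Graphs are finite, simple and undirected. A bipartite graph is chordal bipartite if every cycle of length at least six has a chord. $P_5$-free means no induced path on five vertices. A graph is homogeneously traceable if for every vertex $v$ there is a Hamiltonian path beginning at $v$. -}

module Defs where

open import Data.Nat using (ℕ; zero; suc; _≤_)
open import Data.Fin using (Fin; toℕ)
open import Data.Bool using (Bool)
open import Data.Product using (Σ; ∃; _×_; _,_)
open import Data.Sum using (_⊎_)
open import Relation.Nullary using (¬_; Dec)
open import Relation.Binary.PropositionalEquality using (_≡_; _≢_)
open import Function.Definitions using (Injective)

record Graph (n : ℕ) : Set₁ where
  field
    Adj     : Fin n → Fin n → Set
    adj?    : ∀ u v → Dec (Adj u v)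
    sym     : ∀ {u v} → Adj u v → Adj v u
    irrefl  : ∀ {u} → ¬ Adj u u

module _ {n : ℕ} (G : Graph n) where
  open Graph G

  data Walk : Fin n → Fin n → Set where
    here : ∀ {u} → Walk u u
    step : ∀ {u w v} → Adj u w → Walk w v → Walk u v

  Connected : Set
  Connected = ∀ u v → Walk u v

  Bipartite : Set
  Bipartite = Σ (Fin n → Bool) λ col → ∀ {u v} → Adj u v → col u ≢ col v

  ConsecAdj : {k : ℕ} → (Fin k → Fin n) → Set
  ConsecAdj {k} p = ∀ (i j : Fin k) → toℕ j ≡ suc (toℕ i) → Adj (p i) (p j)

  IsPath : {k : ℕ} → (Fin k → Fin n) → Set
  IsPath p = Injective _≡_ _≡_ p × ConsecAdj p

  IsCycle : {k : ℕ} → (Fin k → Fin n) → Set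
  IsCycle {k} c = 3 ≤ k × IsPath c
    × (∀ (i j : Fin k) → suc (toℕ i) ≡ k → toℕ j ≡ 0 → Adj (c i) (c j))

  CycConsec : {k : ℕ} → Fin k → Fin k → Set
  CycConsec {k} i j =
      toℕ j ≡ suc (toℕ i) ⊎ toℕ i ≡ suc (toℕ j)
    ⊎ (suc (toℕ i) ≡ k × toℕ j ≡ 0) ⊎ (suc (toℕ j) ≡ k × toℕ i ≡ 0)

  HasChord : {k : ℕ} → (Fin k → Fin n) → Set
  HasChord {k} c = Σ (Fin k) λ i → Σ (Fin k) λ j → Adj (c i) (c j) × ¬ CycConsec i j

  ChordalBipartite : Set
  ChordalBipartite = Bipartite ×
    (∀ (k : ℕ) → 6 ≤ k → (c : Fin k → Fin n) → IsCycle c → HasChord c)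

  InducedP5 : (Fin 5 → Fin n) → Set
  InducedP5 p = Injective _≡_ _≡_ p ×
    (∀ (i j : Fin 5) → (Adj (p i) (p j) → toℕ j ≡ suc (toℕ i) ⊎ toℕ i ≡ suc (toℕ j))
                     × (toℕ j ≡ suc (toℕ i) → Adj (p i) (p j)))

  P5Free : Set
  P5Free = ∀ (p : Fin 5 → Fin n) → ¬ InducedP5 p

  -- Hamiltonian path: a path visiting every vertex (n distinct vertices)
  HamPath : (Fin n → Fin n) → Set
  HamPath p = IsPath p

  HomogeneouslyTraceable : Set
  HomogeneouslyTraceable = ∀ (v : Fin n) → Σ (Fin n → Fin n) λ p → HamPath p
    × Σ (Fin n) λ i → toℕ i ≡ 0 × p i ≡ v

  Hamiltonian : Set
  Hamiltonian = Σ (Fin n → Fin n) λ c → IsCycle c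

{-# OPTIONS --safe #-}
-- A Hamiltonian cycle, rotated to start at v and stripped of its closing edge, is a
-- Hamiltonian path from v; this direction holds in every graph.
--
-- Conversely, in a connected P₅-free bipartite graph no two edges induce 2K₂ (a walk
-- between them would produce an induced P₅), so neighbourhoods inside a colour class
-- are nested and a vertex a with maximal neighbourhood is adjacent to the whole other
-- class. Hamiltonian paths alternate colours, and Hamiltonian paths starting in both
-- classes force the classes to have equal size. Hence n is even, and a Hamiltonian
-- path from a ends in the other class, next to a.
module Submission where

open import Defs
open import Data.Bool using (Bool; not)
open import Data.Bool.Properties using (¬-not; not-¬; not-involutive) renaming (_≟_ to _≟ᵇ_)
open import Data.Empty using (⊥; ⊥-elim)
open import Data.Fin using (Fin; toℕ; fromℕ<; punchOut)
open import Data.Fin.Patterns using (0F; 1F; 2F; 3F; 4F)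
open import Data.Fin.Properties
  using (toℕ-injective; toℕ-fromℕ<; fromℕ<-toℕ; toℕ<n; punchOut-injective; <⇒notInjective; any?; all?)
  renaming (_≟_ to _≟ᶠ_)
open import Data.List using (List; []; _∷_; allFin)
open import Data.List.Membership.Propositional.Properties using (∈-allFin)
open import Data.List.Relation.Unary.All as All using (All; []; _∷_)
open import Data.Nat using (ℕ; zero; suc; _+_; _*_; _∸_; _≤_; _<_; z≤n; s≤s)
open import Data.Nat.GeneralisedArithmetic using (fold)
open import Data.Nat.Properties
open import Data.Product using (Σ; ∃; _×_; _,_; proj₁; proj₂)
open import Data.Sum using (_⊎_; inj₁; inj₂)
open import Function using (_∘_)
open import Function.Definitions using (Injective)
open import Relation.Binary.Definitions using (Reflexive; Transitive)
open import Relation.Binary.PropositionalEquality using (_≡_; _≢_; refl; sym; trans; cong; subst; module ≡-Reasoning)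
open import Relation.Nullary using (¬_; Dec; yes; no)
open import Relation.Nullary.Decidable using (decidable-stable; toWitness; _×-dec_; _→-dec_; _⊎-dec_; ¬?)
open import Relation.Unary using (Decidable)

injective⇒surjective : ∀ {n} {f : Fin n → Fin n} → Injective _≡_ _≡_ f → ∀ y → ∃ λ x → f x ≡ y
injective⇒surjective {suc n} {f} f-inj y with any? (λ x → f x ≟ᶠ y)
... | yes hit = hit
... | no miss = ⊥-elim (<⇒notInjective (n<1+n n) g-inj)
  where
  g : Fin (suc n) → Fin n
  g x = punchOut {i = y} (λ y≡fx → miss (x , sym y≡fx))
  g-inj : Injective _≡_ _≡_ g
  g-inj {x} {x′} = f-inj ∘ punchOut-injective {i = y} (λ e → miss (x , sym e)) (λ e → miss (x′ , sym e))

Even Odd : ℕ → Set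
Even k = ∃ λ r → k ≡ 2 * r
Odd k = ∃ λ r → k ≡ suc (2 * r)

even⊎odd : ∀ k → Even k ⊎ Odd k
even⊎odd zero = inj₁ (0 , refl)
even⊎odd (suc k) with even⊎odd k
... | inj₁ (r , refl) = inj₂ (r , refl)
... | inj₂ (r , refl) = inj₁ (suc r , sym (*-suc 2 r))

fold-not-double : ∀ c r → fold c not (2 * r) ≡ c
fold-not-double c zero = refl
fold-not-double c (suc r) = begin
  fold c not (2 * suc r)            ≡⟨ cong (fold c not) (*-suc 2 r) ⟩
  not (not (fold c not (2 * r)))    ≡⟨ not-involutive _ ⟩
  fold c not (2 * r)                ≡⟨ fold-not-double c r ⟩
  c                                 ∎
  where open ≡-Reasoning

-- There are m + 1 even and only m odd positions below 2m + 1.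
evens↛odds : ∀ {n} → Odd n → {f : Fin n → Fin n} → Injective _≡_ _≡_ f
  → (∀ i → Even (toℕ i) → Odd (toℕ (f i))) → ⊥
evens↛odds (m , refl) {f} f-inj even⇒odd = <⇒notInjective (n<1+n m) half-inj
  where
  even : Fin (suc m) → Fin (suc (2 * m))
  even k = fromℕ< (s≤s (*-monoʳ-≤ 2 (≤-pred (toℕ<n k))))

  odd-image : (k : Fin (suc m)) → Σ (Fin m) λ s → toℕ (f (even k)) ≡ suc (2 * toℕ s)
  odd-image k with even⇒odd (even k) (toℕ k , toℕ-fromℕ< _)
  ... | s , fk≡2s+1 = fromℕ< s<m , trans fk≡2s+1 (cong (λ t → suc (2 * t)) (sym (toℕ-fromℕ< s<m)))
    where
    s<m : s < m
    s<m = *-cancelˡ-< 2 s m (≤-pred (subst (_< suc (2 * m)) fk≡2s+1 (toℕ<n (f (even k)))))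

  half-inj : Injective _≡_ _≡_ (proj₁ ∘ odd-image)
  half-inj {k} {l} eq = toℕ-injective (*-cancelˡ-≡ (toℕ k) (toℕ l) 2 (begin
    2 * toℕ k          ≡⟨ sym (toℕ-fromℕ< _) ⟩
    toℕ (even k)       ≡⟨ cong toℕ (f-inj (toℕ-injective same-image)) ⟩
    toℕ (even l)       ≡⟨ toℕ-fromℕ< _ ⟩
    2 * toℕ l          ∎))
    where
    open ≡-Reasoning
    same-image : toℕ (f (even k)) ≡ toℕ (f (even l))
    same-image = trans (proj₂ (odd-image k))
                   (trans (cong (λ t → suc (2 * toℕ t)) eq) (sym (proj₂ (odd-image l))))

module _ {A : Set} {P : A → Set} {R : A → A → Set}
         (R-refl : Reflexive R) (R-trans : Transitive R) (P? : Decidable P)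
         (R-total : ∀ {x y} → P x → P y → R x y ⊎ R y x) where

  maximum : ∀ {x} → P x → (ys : List A) → ∃ λ m → P m × R x m × All (λ y → P y → R y m) ys
  maximum px [] = _ , px , R-refl , []
  maximum px (y ∷ ys) with P? y
  ... | no ¬py =
    let m , pm , xRm , rest = maximum px ys in m , pm , xRm , (⊥-elim ∘ ¬py) ∷ rest
  ... | yes py with R-total px py
  ...   | inj₁ xRy =
    let m , pm , yRm , rest = maximum py ys in m , pm , R-trans xRy yRm , (λ _ → yRm) ∷ rest
  ...   | inj₂ yRx =
    let m , pm , xRm , rest = maximum px ys in m , pm , xRm , (λ _ → R-trans yRx xRm) ∷ rest

wrap-mismatch : ∀ {a b c n} → a < n → a + c ≢ b + c + n
wrap-mismatch {a} {b} {c} {n} a<n eq = <-irrefl eq (begin-strict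
  a + c        <⟨ +-monoˡ-< c a<n ⟩
  n + c        ≡⟨ +-comm n c ⟩
  c + n        ≤⟨ m≤n+m (c + n) b ⟩
  b + (c + n)  ≡⟨ sym (+-assoc b c n) ⟩
  b + c + n    ∎)
  where open ≤-Reasoning

module _ {n : ℕ} (J : Fin n) where

  rotate : Fin n → Fin n
  rotate i with toℕ i + toℕ J <? n
  ... | yes i+J<n = fromℕ< i+J<n
  ... | no  i+J≮n = fromℕ< (subst (toℕ i + toℕ J ∸ n <_) (m+n∸n≡m n n)
                             (∸-monoˡ-< (+-mono-< (toℕ<n i) (toℕ<n J)) (≮⇒≥ i+J≮n)))

  rotate-spec : ∀ i → (toℕ (rotate i) ≡ toℕ i + toℕ J × toℕ i + toℕ J < n)
                    ⊎ (toℕ (rotate i) + n ≡ toℕ i + toℕ J × n ≤ toℕ i + toℕ J)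
  rotate-spec i with toℕ i + toℕ J <? n
  ... | yes i+J<n = inj₁ (toℕ-fromℕ< _ , i+J<n)
  ... | no  i+J≮n = inj₂ (trans (cong (_+ n) (toℕ-fromℕ< _)) (m∸n+n≡m (≮⇒≥ i+J≮n)) , ≮⇒≥ i+J≮n)

  rotate-start : ∀ {i} → toℕ i ≡ 0 → rotate i ≡ J
  rotate-start {i} i≡0 with rotate-spec i
  ... | inj₁ (r≡s , _) = toℕ-injective (trans r≡s (cong (_+ toℕ J) i≡0))
  ... | inj₂ (_ , n≤s) = ⊥-elim (<⇒≱ (toℕ<n J) (subst (n ≤_) (cong (_+ toℕ J) i≡0) n≤s))

  offset-injective : ∀ {i i′ : Fin n} → toℕ i + toℕ J ≡ toℕ i′ + toℕ J → i ≡ i′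
  offset-injective = toℕ-injective ∘ +-cancelʳ-≡ (toℕ J) _ _

  rotate-injective : Injective _≡_ _≡_ rotate
  rotate-injective {i} {i′} eq with rotate-spec i | rotate-spec i′
  ... | inj₁ (r≡s , _) | inj₁ (r′≡s′ , _) =
    offset-injective (trans (sym r≡s) (trans (cong toℕ eq) r′≡s′))
  ... | inj₂ (r≡s , _) | inj₂ (r′≡s′ , _) =
    offset-injective (trans (sym r≡s) (trans (cong (λ x → toℕ x + n) eq) r′≡s′))
  ... | inj₁ (r≡s , _) | inj₂ (r′≡s′ , _) =
    ⊥-elim (wrap-mismatch (toℕ<n i′) (trans (sym r′≡s′) (cong (_+ n) (trans (cong toℕ (sym eq)) r≡s))))
  ... | inj₂ (r≡s , _) | inj₁ (r′≡s′ , _) =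
    ⊥-elim (wrap-mismatch (toℕ<n i) (trans (sym r≡s) (cong (_+ n) (trans (cong toℕ eq) r′≡s′))))

  rotate-suc : ∀ {i i′} → toℕ i′ ≡ suc (toℕ i) →
    toℕ (rotate i′) ≡ suc (toℕ (rotate i)) ⊎ (suc (toℕ (rotate i)) ≡ n × toℕ (rotate i′) ≡ 0)
  rotate-suc {i} {i′} i′≡1+i with rotate-spec i | rotate-spec i′ | cong (_+ toℕ J) i′≡1+i
  ... | inj₁ (r≡s , _) | inj₁ (r′≡s′ , _) | s′≡1+s =
    inj₁ (trans r′≡s′ (trans s′≡1+s (cong suc (sym r≡s))))
  ... | inj₂ (r≡s , _) | inj₂ (r′≡s′ , _) | s′≡1+s =
    inj₁ (+-cancelʳ-≡ n _ _ (trans r′≡s′ (trans s′≡1+s (cong suc (sym r≡s)))))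
  ... | inj₂ (_ , n≤s) | inj₁ (_ , s′<n) | s′≡1+s =
    ⊥-elim (<⇒≱ (subst (_< n) s′≡1+s s′<n) (m≤n⇒m≤1+n n≤s))
  ... | inj₁ (r≡s , s<n) | inj₂ (r′≡s′ , n≤s′) | s′≡1+s =
    inj₂ (trans (cong suc r≡s) 1+s≡n , +-cancelʳ-≡ n _ 0 (trans r′≡s′ (trans s′≡1+s 1+s≡n)))
    where
    1+s≡n : suc (toℕ i + toℕ J) ≡ n
    1+s≡n = ≤-antisym s<n (subst (n ≤_) s′≡1+s n≤s′)

Consecutive : ∀ {k} → Fin k → Fin k → Set
Consecutive i j = toℕ j ≡ suc (toℕ i) ⊎ toℕ i ≡ suc (toℕ j)

consecutive? : ∀ {k} (i j : Fin k) → Dec (Consecutive i j)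
consecutive? i j = (toℕ j ≟ suc (toℕ i)) ⊎-dec (toℕ i ≟ suc (toℕ j))

P₅-neighbourhood-injective : ∀ (i j : Fin 5)
  → (∀ k → Consecutive i k → Consecutive j k) → (∀ k → Consecutive j k → Consecutive i k) → i ≡ j
P₅-neighbourhood-injective = toWitness {a? = all? λ i → all? λ j →
  all? (λ k → consecutive? i k →-dec consecutive? j k) →-dec
  all? (λ k → consecutive? j k →-dec consecutive? i k) →-dec i ≟ᶠ j} _

module _ {n : ℕ} (G : Graph n) where
  open Graph G renaming (sym to adj-sym)

  hamiltonian⇒homogeneouslyTraceable : Hamiltonian G → HomogeneouslyTraceable G
  hamiltonian⇒homogeneouslyTraceable (c , 3≤n , (c-inj , c-adj) , c-closes) v
    with injective⇒surjective c-inj v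
  ... | J , cJ≡v =
    c ∘ rotate J , (rotate-injective J ∘ c-inj , rotated-adj) , i₀ , toℕ-fromℕ< _ , starts-at-v
    where
    rotated-adj : ConsecAdj G (c ∘ rotate J)
    rotated-adj i i′ i′≡1+i with rotate-suc J i′≡1+i
    ... | inj₁ next = c-adj _ _ next
    ... | inj₂ (last , first) = c-closes _ _ last first

    i₀ : Fin n
    i₀ = fromℕ< (≤-trans (s≤s z≤n) 3≤n)

    starts-at-v : c (rotate J i₀) ≡ v
    starts-at-v = trans (cong c (rotate-start J (toℕ-fromℕ< _))) cJ≡v

  P₅-adjacency : (Fin 5 → Fin n) → Set
  P₅-adjacency p = ∀ i j → (Adj (p i) (p j) → Consecutive i j) × (toℕ j ≡ suc (toℕ i) → Adj (p i) (p j))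

  P₅-adjacency⇒injective : ∀ {p} → P₅-adjacency p → Injective _≡_ _≡_ p
  P₅-adjacency⇒injective {p} adjacency {i} {j} pi≡pj =
    P₅-neighbourhood-injective i j (shared pi≡pj) (shared (sym pi≡pj))
    where
    edge : ∀ {i k} → Consecutive i k → Adj (p i) (p k)
    edge {i} {k} (inj₁ k≡1+i) = proj₂ (adjacency i k) k≡1+i
    edge {i} {k} (inj₂ i≡1+k) = adj-sym (proj₂ (adjacency k i) i≡1+k)

    shared : ∀ {i j} → p i ≡ p j → ∀ k → Consecutive i k → Consecutive j k
    shared {j = j} pi≡pj k ik = proj₁ (adjacency j k) (subst (λ x → Adj x (p k)) pi≡pj (edge ik))

  path₅ : Fin n → Fin n → Fin n → Fin n → Fin n → Fin 5 → Fin n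
  path₅ a b c d e 0F = a
  path₅ a b c d e 1F = b
  path₅ a b c d e 2F = c
  path₅ a b c d e 3F = d
  path₅ a b c d e 4F = e

  inducedP₅ : ∀ {a b c d e} → Adj a b → Adj b c → Adj c d → Adj d e
    → ¬ Adj a c → ¬ Adj a d → ¬ Adj a e → ¬ Adj b d → ¬ Adj b e → ¬ Adj c e
    → InducedP5 G (path₅ a b c d e)
  inducedP₅ {a} {b} {c} {d} {e} ab bc cd de ¬ac ¬ad ¬ae ¬bd ¬be ¬ce =
    P₅-adjacency⇒injective adjacency , adjacency
    where
    adjacency : P₅-adjacency (path₅ a b c d e)
    adjacency 0F 0F = ⊥-elim ∘ irrefl , λ ()
    adjacency 0F 1F = (λ _ → inj₁ refl) , λ _ → ab
    adjacency 0F 2F = ⊥-elim ∘ ¬ac , λ ()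
    adjacency 0F 3F = ⊥-elim ∘ ¬ad , λ ()
    adjacency 0F 4F = ⊥-elim ∘ ¬ae , λ ()
    adjacency 1F 0F = (λ _ → inj₂ refl) , λ ()
    adjacency 1F 1F = ⊥-elim ∘ irrefl , λ ()
    adjacency 1F 2F = (λ _ → inj₁ refl) , λ _ → bc
    adjacency 1F 3F = ⊥-elim ∘ ¬bd , λ ()
    adjacency 1F 4F = ⊥-elim ∘ ¬be , λ ()
    adjacency 2F 0F = ⊥-elim ∘ ¬ac ∘ adj-sym , λ ()
    adjacency 2F 1F = (λ _ → inj₂ refl) , λ ()
    adjacency 2F 2F = ⊥-elim ∘ irrefl , λ ()
    adjacency 2F 3F = (λ _ → inj₁ refl) , λ _ → cd
    adjacency 2F 4F = ⊥-elim ∘ ¬ce , λ ()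
    adjacency 3F 0F = ⊥-elim ∘ ¬ad ∘ adj-sym , λ ()
    adjacency 3F 1F = ⊥-elim ∘ ¬bd ∘ adj-sym , λ ()
    adjacency 3F 2F = (λ _ → inj₂ refl) , λ ()
    adjacency 3F 3F = ⊥-elim ∘ irrefl , λ ()
    adjacency 3F 4F = (λ _ → inj₁ refl) , λ _ → de
    adjacency 4F 0F = ⊥-elim ∘ ¬ae ∘ adj-sym , λ ()
    adjacency 4F 1F = ⊥-elim ∘ ¬be ∘ adj-sym , λ ()
    adjacency 4F 2F = ⊥-elim ∘ ¬ce ∘ adj-sym , λ ()
    adjacency 4F 3F = (λ _ → inj₂ refl) , λ ()
    adjacency 4F 4F = ⊥-elim ∘ irrefl , λ ()

  _≼_ : Fin n → Fin n → Set
  u ≼ v = ∀ {w} → Adj u w → Adj v w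

  module _ (bipartite : Bipartite G) where

    col : Fin n → Bool
    col = proj₁ bipartite

    adj⇒opposite : ∀ {u v} → Adj u v → col v ≡ not (col u)
    adj⇒opposite uv = ¬-not (proj₂ bipartite uv ∘ sym)

    same⇒¬adj : ∀ {u v} → col u ≡ col v → ¬ Adj u v
    same⇒¬adj same uv = proj₂ bipartite uv same

    ¬triangle : ∀ {u v w} → Adj u v → Adj v w → ¬ Adj u w
    ¬triangle {u} {v} {w} uv vw = same⇒¬adj (sym (begin
      col w                 ≡⟨ adj⇒opposite vw ⟩
      not (col v)           ≡⟨ cong not (adj⇒opposite uv) ⟩
      not (not (col u))     ≡⟨ not-involutive _ ⟩
      col u                 ∎))
      where open ≡-Reasoning

    neighbours-same-colour : ∀ {u v w w′} → col u ≡ col v → Adj u w → Adj v w′ → col w ≡ col w′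
    neighbours-same-colour same uw vw′ =
      trans (adj⇒opposite uw) (trans (cong not same) (sym (adj⇒opposite vw′)))

    path-colour : ∀ {p : Fin n → Fin n} {i₀} → ConsecAdj G p → toℕ i₀ ≡ 0
      → ∀ i → col (p i) ≡ fold (col (p i₀)) not (toℕ i)
    path-colour {p} {i₀} p-adj i₀≡0 i =
      trans (cong (col ∘ p) (sym (fromℕ<-toℕ i (toℕ<n i)))) (along (toℕ i) (toℕ<n i))
      where
      along : ∀ k (k<n : k < n) → col (p (fromℕ< k<n)) ≡ fold (col (p i₀)) not k
      along zero 0<n = cong (col ∘ p) (toℕ-injective (trans (toℕ-fromℕ< 0<n) (sym i₀≡0)))
      along (suc k) 1+k<n =
        trans (adj⇒opposite (p-adj _ _ (trans (toℕ-fromℕ< _) (cong suc (sym (toℕ-fromℕ< k<n))))))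
              (cong not (along k k<n))
        where
        k<n : k < n
        k<n = <-trans (n<1+n k) 1+k<n

    path-colour-even : ∀ {p : Fin n → Fin n} {i₀ i} → ConsecAdj G p → toℕ i₀ ≡ 0
      → Even (toℕ i) → col (p i) ≡ col (p i₀)
    path-colour-even {i = i} p-adj i₀≡0 (r , i≡2r) =
      trans (path-colour p-adj i₀≡0 i) (trans (cong (fold _ not) i≡2r) (fold-not-double _ r))

    path-colour-odd : ∀ {p : Fin n → Fin n} {i₀ i} → ConsecAdj G p → toℕ i₀ ≡ 0
      → Odd (toℕ i) → col (p i) ≡ not (col (p i₀))
    path-colour-odd {i = i} p-adj i₀≡0 (r , i≡2r+1) =
      trans (path-colour p-adj i₀≡0 i) (trans (cong (fold _ not) i≡2r+1) (cong not (fold-not-double _ r)))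

    -- Reading q⁻¹ ∘ p, every even position of p lands on an odd position of q.
    opposite-starts⇒¬odd : ∀ {p q : Fin n → Fin n} {i₀ j₀} → HamPath G p → HamPath G q
      → toℕ i₀ ≡ 0 → toℕ j₀ ≡ 0 → col (q j₀) ≡ not (col (p i₀)) → ¬ Odd n
    opposite-starts⇒¬odd {p} {q} {i₀} {j₀} (p-inj , p-adj) (q-inj , q-adj) i₀≡0 j₀≡0 opposite n-odd =
      evens↛odds n-odd position-in-q-injective even↦odd
      where
      position-in-q : Fin n → Fin n
      position-in-q i = proj₁ (injective⇒surjective q-inj (p i))

      same-vertex : ∀ i → q (position-in-q i) ≡ p i
      same-vertex i = proj₂ (injective⇒surjective q-inj (p i))

      position-in-q-injective : Injective _≡_ _≡_ position-in-q
      position-in-q-injective {i} {j} eq =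
        p-inj (trans (sym (same-vertex i)) (trans (cong q eq) (same-vertex j)))

      even↦odd : ∀ i → Even (toℕ i) → Odd (toℕ (position-in-q i))
      even↦odd i i-even with even⊎odd (toℕ (position-in-q i))
      ... | inj₂ odd = odd
      ... | inj₁ even = ⊥-elim (not-¬ refl (begin
        col (p i₀)               ≡⟨ sym (path-colour-even p-adj i₀≡0 i-even) ⟩
        col (p i)                ≡⟨ cong col (sym (same-vertex i)) ⟩
        col (q (position-in-q i)) ≡⟨ path-colour-even q-adj j₀≡0 even ⟩
        col (q j₀)               ≡⟨ opposite ⟩
        not (col (p i₀))         ∎))
        where open ≡-Reasoning

    homogeneouslyTraceable⇒¬odd : 2 ≤ n → HomogeneouslyTraceable G → ¬ Odd n
    homogeneouslyTraceable⇒¬odd 2≤n traceable =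
      let p , p-path , i₀ , i₀≡0 , _ = traceable i₁
          q , q-path , j₀ , j₀≡0 , qj₀≡pi₁ = traceable (p i₁)
          p₀p₁ = proj₂ p-path i₀ i₁ (trans (toℕ-fromℕ< 2≤n) (cong suc (sym i₀≡0)))
      in opposite-starts⇒¬odd p-path q-path i₀≡0 j₀≡0 (trans (cong col qj₀≡pi₁) (adj⇒opposite p₀p₁))
      where
      i₁ : Fin n
      i₁ = fromℕ< 2≤n

    module _ (connected : Connected G) (p5-free : P5Free G) where

      induced2K₂-unreachable : ∀ {x y z t} → Adj x y → Adj z t
        → ¬ Adj x z → ¬ Adj x t → ¬ Adj y z → ¬ Adj y t → ¬ Walk G y z
      induced2K₂-unreachable xy zt ¬xz ¬xt ¬yz ¬yt here = ¬xz xy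
      induced2K₂-unreachable {x} {y} {z} {t} xy zt ¬xz ¬xt ¬yz ¬yt (step {w = w} yw walk)
        with adj? w t | adj? w z
      ... | yes wt | _ =
        p5-free _ (inducedP₅ xy yw wt (adj-sym zt) (¬triangle xy yw) ¬xt ¬xz ¬yt ¬yz (¬triangle wt (adj-sym zt)))
      ... | no _ | yes wz =
        p5-free _ (inducedP₅ xy yw wz zt (¬triangle xy yw) ¬xz ¬xt ¬yz ¬yt (¬triangle wz zt))
      ... | no ¬wt | no ¬wz = induced2K₂-unreachable yw zt ¬yz ¬yt ¬wz ¬wt walk

      neighbourhoods-nested : ∀ {u v} → col u ≡ col v → u ≼ v ⊎ v ≼ u
      neighbourhoods-nested {u} {v} same with any? (λ w → adj? u w ×-dec ¬? (adj? v w))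
      ... | no none = inj₁ λ {w} uw → decidable-stable (adj? v w) (λ ¬vw → none (w , uw , ¬vw))
      ... | yes (w , uw , ¬vw) = inj₂ λ {w′} vw′ → decidable-stable (adj? u w′) λ ¬uw′ →
        induced2K₂-unreachable (adj-sym uw) vw′ (¬vw ∘ adj-sym)
          (same⇒¬adj (neighbours-same-colour same uw vw′)) (same⇒¬adj same) ¬uw′ (connected u v)

      dominating-vertex : Fin n → ∃ λ a → ∀ b → col b ≡ not (col a) → Adj a b
      dominating-vertex a₀
        with maximum {P = λ v → col v ≡ col a₀} {R = _≼_} (λ uw → uw) (λ uv vw → vw ∘ uv)
               (λ v → col v ≟ᵇ col a₀) (λ pu pv → neighbourhoods-nested (trans pu (sym pv)))
               refl (allFin n)
      ... | a , a-col , _ , a-above = a , dominates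
        where
        dominates : ∀ b → col b ≡ not (col a) → Adj a b
        dominates b b-opposite with connected b a
        ... | here = ⊥-elim (not-¬ refl b-opposite)
        ... | step {w = w} bw _ = All.lookup a-above (∈-allFin w) w-col (adj-sym bw)
          where
          w-col : col w ≡ col a₀
          w-col = begin
            col w               ≡⟨ adj⇒opposite bw ⟩
            not (col b)         ≡⟨ cong not b-opposite ⟩
            not (not (col a))   ≡⟨ not-involutive _ ⟩
            col a               ≡⟨ a-col ⟩
            col a₀              ∎
            where open ≡-Reasoning

      homogeneouslyTraceable⇒hamiltonian : 3 ≤ n → HomogeneouslyTraceable G → Hamiltonian G
      homogeneouslyTraceable⇒hamiltonian 3≤n traceable
        with dominating-vertex (fromℕ< (≤-trans (s≤s z≤n) 3≤n))
      ... | a , dominates with traceable a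
      ... | p , p-path , i₀ , i₀≡0 , pi₀≡a = p , 3≤n , p-path , closes
        where
        closes : ∀ i j → suc (toℕ i) ≡ n → toℕ j ≡ 0 → Adj (p i) (p j)
        closes i j last first with even⊎odd (toℕ i)
        ... | inj₁ (r , i≡2r) =
          ⊥-elim (homogeneouslyTraceable⇒¬odd (≤-trans (n≤1+n 2) 3≤n) traceable
                   (r , trans (sym last) (cong suc i≡2r)))
        ... | inj₂ i-odd = subst (Adj (p i)) (sym pj≡a) (adj-sym (dominates (p i) pi-opposite))
          where
          pi-opposite : col (p i) ≡ not (col a)
          pi-opposite = trans (path-colour-odd (proj₂ p-path) i₀≡0 i-odd) (cong (not ∘ col) pi₀≡a)

          pj≡a : p j ≡ a
          pj≡a = trans (cong p (toℕ-injective (trans first (sym i₀≡0)))) pi₀≡a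

theorem8 : (n : ℕ) → 3 ≤ n → (G : Graph n) → Connected G → P5Free G → ChordalBipartite G
    → (Hamiltonian G → HomogeneouslyTraceable G) × (HomogeneouslyTraceable G → Hamiltonian G)
theorem8 n 3≤n G connected p5-free (bipartite , _) =
  hamiltonian⇒homogeneouslyTraceable G ,
  homogeneouslyTraceable⇒hamiltonian G bipartite connected p5-free 3≤n
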